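{- Let $F$ be a filter on $\omega$ containing all cofinite subsets of $\omega$, let $\pi,f:\omega\to\omega$ and $T\subseteq\mathcal{P}(\omega)$, and suppose $\diamondsuit^-(F,\pi,f,T)$ holds. Then either $\sum_{n=0}^{\infty}\frac{\pi(n)}{2^{f(n)}}=\infty$, or $\mathbb{P}(T)=0$ (i.e. $T$ is null), where $\mathbb{P}$ is the standard (fair coin product) Borel probability measure on $\mathcal{P}(\omega)\cong 2^\omega$.
   Context: For a filter $F$ on $\omega$, a set $A\subseteq\omega$ is $F$-positive if $A\cap B\neq\emptyset$ for every $B\in F$. For $\pi,f:\omega\to\omega$ and $T\subseteq\mathcal{P}(\omega)$, $\diamondsuit^-(F,\pi,f,T)$ means: there is a sequence $\langle\mathcal{A}_n\mid n<\omega\rangle$ with $\mathcal{A}_n\subseteq\mathcal{P}(f(n))$ and $|\mathcal{A}_n|\le\pi(n)$ for all $n$, such that for every $X\in T$ the set $\{n<\omega\mid X\cap f(n)\in\mathcal{A}_n\}$ is $F$-positive. Here $f(n)=\{0,\dots,f(n)-1\}$. -}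

module Defs where

open import Data.Nat using (ℕ; zero; suc; _+_; _≤_)
open import Data.Bool using (Bool; true; false)
open import Data.Fin using (Fin; toℕ)
open import Data.Vec using (Vec; tabulate)
open import Data.List using (List; length; map; upTo)
open import Data.List.Membership.Propositional using (_∈_)
open import Data.Product using (Σ; ∃; _×_; _,_)
open import Data.Empty using (⊥)
open import Data.Integer using (+_)
open import Data.Rational using (ℚ; 0ℚ; 1ℚ; ½; _/_) renaming (_+_ to _+ℚ_; _*_ to _*ℚ_; _≤_ to _≤ℚ_; _<_ to _<ℚ_)
open import Relation.Binary.PropositionalEquality using (_≡_)

Subset : Set
Subset = ℕ → Bool

_⊆_ : Subset → Subset → Set
A ⊆ B = ∀ n → A n ≡ true → B n ≡ true

_∩_ : Subset → Subset → Subset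
(A ∩ B) n = Data.Bool._∧_ (A n) (B n)

full : Subset
full _ = true

empty : Subset
empty _ = false

Cofinite : Subset → Set
Cofinite A = ∃ λ N → ∀ n → N ≤ n → A n ≡ true

record IsFilter (F : Subset → Set) : Set₁ where
  field
    hasFull  : F full
    noEmpty  : F empty → ⊥
    upward   : ∀ A B → F A → A ⊆ B → F B
    meet     : ∀ A B → F A → F B → F (A ∩ B)

ContainsCofinite : (Subset → Set) → Set
ContainsCofinite F = ∀ A → Cofinite A → F A

Positive : (Subset → Set) → (ℕ → Set) → Set
Positive F A = ∀ B → F B → ∃ λ n → A n × B n ≡ true

-- X ∩ k viewed as an element of P(k) (a bit vector of length k).
restrict : Subset → (k : ℕ) → Vec Bool k
restrict X k = tabulate (λ i → X (toℕ i))

-- ◇⁻(F, π, f, T): 𝒜 n is a finite family of subsets of f(n), listed, of size ≤ π(n).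
Diamond⁻ : (Subset → Set) → (ℕ → ℕ) → (ℕ → ℕ) → (Subset → Set) → Set
Diamond⁻ F π f T =
  Σ ((n : ℕ) → List (Vec Bool (f n))) λ 𝒜 →
    (∀ n → length (𝒜 n) ≤ π n) ×
    (∀ X → T X → Positive F (λ n → restrict X (f n) ∈ 𝒜 n))

half^ : ℕ → ℚ
half^ zero = 1ℚ
half^ (suc k) = ½ *ℚ half^ k

sumFrom : (ℕ → ℚ) → ℕ → ℕ → ℚ
sumFrom g N zero = 0ℚ
sumFrom g N (suc m) = sumFrom g N m +ℚ g (N + m)

-- The series Σ g(n) converges (Cauchy criterion for partial sums).
Converges : (ℕ → ℚ) → Set
Converges g = ∀ ε → 0ℚ <ℚ ε → ∃ λ N → ∀ m → sumFrom g N m ≤ℚ ε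

Extends : Subset → List Bool → Set
Extends X s = map X (upTo (length s)) ≡ s

-- T has (outer) fair-coin measure 0: covers by basic cylinders of arbitrarily small total measure.
Null : (Subset → Set) → Set
Null T = ∀ ε → 0ℚ <ℚ ε →
  Σ (ℕ → List Bool) λ c →
    (∀ m → sumFrom (λ k → half^ (length (c k))) 0 m ≤ℚ ε) ×
    (∀ X → T X → ∃ λ k → Extends X (c k))

term : (ℕ → ℕ) → (ℕ → ℕ) → ℕ → ℚ
term π f n = ((+ π n) / 1) *ℚ half^ (f n)

-- Fix ε > 0. By convergence there is N with Σ_{n ≥ N} π(n) / 2^{f(n)} ≤ ε. The cylinders of the
-- guesses in 𝒜 n for n ≥ N have total measure at most that tail, since 𝒜 n holds at most π n
-- strings of length f n. Every X ∈ T has the cofinite set {n | N ≤ n} meeting its F-positive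
-- set of correct guesses, so X extends some guess in 𝒜 n with n ≥ N: these cylinders cover T.
module Submission where

open import Defs
open import Data.Nat as ℕ using (ℕ; zero; suc; _∸_; _≤ᵇ_)
import Data.Nat.Properties as ℕ
open import Data.Integer as ℤ using (+_; +[1+_]; -[1+_])
import Data.Integer.Properties as ℤ
open import Data.Rational as ℚ using (ℚ; mkℚ; 0ℚ; 1ℚ; ½; toℚᵘ; _/_)
import Data.Rational.Properties as ℚ
import Data.Rational.Unnormalised as ℚᵘ
import Data.Rational.Unnormalised.Properties as ℚᵘ
open import Data.Bool using (Bool; false)
open import Data.Bool.Properties using (T-≡)
open import Data.Fin using (toℕ)
open import Data.List as List using (List; []; _∷_; map; length; replicate; applyUpTo)
import Data.List.Properties as List
open import Data.List.Membership.Propositional using (_∈_)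
open import Data.List.Membership.Propositional.Properties using (∈-map⁺)
open import Data.List.Relation.Unary.Any using (here; there)
open import Data.Vec as Vec using (Vec; toList; tabulate)
import Data.Vec.Properties as Vec
open import Data.Product using (Σ; ∃; ∃₂; _×_; _,_)
open import Function using (_∘_; Equivalence)
open import Relation.Binary.PropositionalEquality
open import Algebra.Bundles using (CommutativeMonoid)
open import Algebra.Properties.CommutativeSemigroup
  (CommutativeMonoid.commutativeSemigroup ℚ.+-0-commutativeMonoid)
  using () renaming (interchange to +-interchange)

private
  variable
    A : Set

/1-mono-≤ : ∀ {m n} → m ℕ.≤ n → + m / 1 ℚ.≤ + n / 1
/1-mono-≤ {m} {n} m≤n = ℚ.toℚᵘ-cancel-≤ (begin
  toℚᵘ (+ m / 1)       ≃⟨ ℚ.toℚᵘ-fromℚᵘ (ℚᵘ.mkℚᵘ (+ m) 0) ⟩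
  ℚᵘ.mkℚᵘ (+ m) 0      ≤⟨ ℚᵘ.*≤* (ℤ.*-monoʳ-≤-nonNeg (+ 1) (ℤ.+≤+ m≤n)) ⟩
  ℚᵘ.mkℚᵘ (+ n) 0      ≃⟨ ℚ.toℚᵘ-fromℚᵘ (ℚᵘ.mkℚᵘ (+ n) 0) ⟨
  toℚᵘ (+ n / 1)       ∎)
  where open ℚᵘ.≤-Reasoning

/1-suc : ∀ n → + suc n / 1 ≡ 1ℚ ℚ.+ + n / 1
/1-suc n = ℚ.toℚᵘ-injective (begin
  toℚᵘ (+ suc n / 1)                ≈⟨ ℚ.toℚᵘ-fromℚᵘ (ℚᵘ.mkℚᵘ (+ suc n) 0) ⟩
  ℚᵘ.mkℚᵘ (+ suc n) 0               ≈⟨ ℚᵘ.*≡* (trans (ℤ.*-identityʳ _) (sym (trans (ℤ.*-identityʳ _)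
                                                 (cong (λ k → ℤ.1ℤ ℤ.+ k) (ℤ.*-identityʳ (+ n)))))) ⟩
  ℚᵘ.1ℚᵘ ℚᵘ.+ ℚᵘ.mkℚᵘ (+ n) 0       ≈⟨ ℚᵘ.+-congʳ ℚᵘ.1ℚᵘ (ℚ.toℚᵘ-fromℚᵘ (ℚᵘ.mkℚᵘ (+ n) 0)) ⟨
  toℚᵘ 1ℚ ℚᵘ.+ toℚᵘ (+ n / 1)       ≈⟨ ℚ.toℚᵘ-homo-+ 1ℚ (+ n / 1) ⟨
  toℚᵘ (1ℚ ℚ.+ + n / 1)             ∎)
  where open ℚᵘ.≃-Reasoning

half^-nonNeg : ∀ k → 0ℚ ℚ.≤ half^ k
half^-nonNeg zero    = ℚ.*≤* (ℤ.+≤+ ℕ.z≤n)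
half^-nonNeg (suc k) = subst (ℚ._≤ ½ ℚ.* half^ k) (ℚ.*-zeroʳ ½) (ℚ.*-monoˡ-≤-nonNeg ½ (half^-nonNeg k))

half-+-half : ∀ p → ½ ℚ.* p ℚ.+ ½ ℚ.* p ≡ p
half-+-half p = trans (sym (ℚ.*-distribʳ-+ p ½ ½)) (ℚ.*-identityˡ p)

half-pos : ∀ {p} → 0ℚ ℚ.< p → 0ℚ ℚ.< ½ ℚ.* p
half-pos {p} p>0 = subst (ℚ._< ½ ℚ.* p) (ℚ.*-zeroʳ ½) (ℚ.*-monoʳ-<-pos ½ p>0)

-- pred2^ L = 2 ^ L ∸ 1
pred2^ : ℕ → ℕ
pred2^ zero    = 0
pred2^ (suc L) = suc (2 ℕ.* pred2^ L)

n≤pred2^n : ∀ n → n ℕ.≤ pred2^ n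
n≤pred2^n zero    = ℕ.z≤n
n≤pred2^n (suc n) = ℕ.s≤s (ℕ.≤-trans (n≤pred2^n n) (ℕ.m≤m+n (pred2^ n) _))

toℚᵘ-half^ : ∀ L → toℚᵘ (half^ L) ℚᵘ.≃ ℚᵘ.mkℚᵘ (+ 1) (pred2^ L)
toℚᵘ-half^ zero    = ℚᵘ.≃-refl
toℚᵘ-half^ (suc L) = begin
  toℚᵘ (½ ℚ.* half^ L)                    ≈⟨ ℚ.toℚᵘ-homo-* ½ (half^ L) ⟩
  toℚᵘ ½ ℚᵘ.* toℚᵘ (half^ L)              ≈⟨ ℚᵘ.*-congˡ {toℚᵘ ½} (toℚᵘ-half^ L) ⟩
  toℚᵘ ½ ℚᵘ.* ℚᵘ.mkℚᵘ (+ 1) (pred2^ L)    ≈⟨ ℚᵘ.*≡* (cong (λ d → + 1 ℤ.* + suc d)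
                                                (sym (ℕ.+-suc (pred2^ L) (pred2^ L ℕ.+ 0)))) ⟩
  ℚᵘ.mkℚᵘ (+ 1) (pred2^ (suc L))          ∎
  where open ℚᵘ.≃-Reasoning

-- A positive mkℚ (1 + k) d is at least 1 / (1 + d) > 1 / 2 ^ (1 + d).
half^-eventually-≤ : ∀ ε → 0ℚ ℚ.< ε → ∃ λ L → half^ L ℚ.≤ ε
half^-eventually-≤ (mkℚ +[1+ k ] d _) _ = suc d , ℚ.toℚᵘ-cancel-≤
  (ℚᵘ.≤-respˡ-≃ (ℚᵘ.≃-sym (toℚᵘ-half^ (suc d))) (ℚᵘ.*≤* (ℤ.+≤+ 1+d≤[1+k]2^[1+d])))
  where
  1+d≤[1+k]2^[1+d] : 1 ℕ.* suc d ℕ.≤ suc k ℕ.* suc (pred2^ (suc d))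
  1+d≤[1+k]2^[1+d] = begin
    1 ℕ.* suc d                      ≡⟨ ℕ.*-identityˡ (suc d) ⟩
    suc d                            ≤⟨ ℕ.n≤1+n (suc d) ⟩
    suc (suc d)                      ≤⟨ ℕ.s≤s (n≤pred2^n (suc d)) ⟩
    suc (pred2^ (suc d))             ≤⟨ ℕ.m≤n*m _ (suc k) ⟩
    suc k ℕ.* suc (pred2^ (suc d))   ∎
    where open ℕ.≤-Reasoning
half^-eventually-≤ (mkℚ (+ 0)    _ _) (ℚ.*<* (ℤ.+<+ ()))
half^-eventually-≤ (mkℚ -[1+ _ ] _ _) (ℚ.*<* ())

sumFrom-shift : ∀ g N m → sumFrom g N m ≡ sumFrom (λ i → g (N ℕ.+ i)) 0 m
sumFrom-shift g N zero    = refl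
sumFrom-shift g N (suc m) = cong (ℚ._+ g (N ℕ.+ m)) (sumFrom-shift g N m)

sumFrom-cons : ∀ g m → sumFrom g 0 (suc m) ≡ g 0 ℚ.+ sumFrom (g ∘ suc) 0 m
sumFrom-cons g zero    = trans (ℚ.+-identityˡ (g 0)) (sym (ℚ.+-identityʳ (g 0)))
sumFrom-cons g (suc m) = begin
  sumFrom g 0 (suc m) ℚ.+ g (suc m)                  ≡⟨ cong (ℚ._+ g (suc m)) (sumFrom-cons g m) ⟩
  g 0 ℚ.+ sumFrom (g ∘ suc) 0 m ℚ.+ g (suc m)        ≡⟨ ℚ.+-assoc (g 0) _ _ ⟩
  g 0 ℚ.+ sumFrom (g ∘ suc) 0 (suc m)                ∎
  where open ≡-Reasoning

sumFrom-+ : ∀ g h N m → sumFrom (λ i → g i ℚ.+ h i) N m ≡ sumFrom g N m ℚ.+ sumFrom h N m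
sumFrom-+ g h N zero    = sym (ℚ.+-identityˡ 0ℚ)
sumFrom-+ g h N (suc m) = trans (cong (ℚ._+ (g (N ℕ.+ m) ℚ.+ h (N ℕ.+ m))) (sumFrom-+ g h N m))
  (+-interchange (sumFrom g N m) (sumFrom h N m) (g (N ℕ.+ m)) (h (N ℕ.+ m)))

sumFrom-mono-≤ : ∀ {g h} → (∀ i → g i ℚ.≤ h i) → ∀ N m → sumFrom g N m ℚ.≤ sumFrom h N m
sumFrom-mono-≤ g≤h N zero    = ℚ.≤-refl
sumFrom-mono-≤ g≤h N (suc m) = ℚ.+-mono-≤ (sumFrom-mono-≤ g≤h N m) (g≤h (N ℕ.+ m))

sumFrom-≤-suc : ∀ {g} → (∀ i → 0ℚ ℚ.≤ g i) → ∀ N m → sumFrom g N m ℚ.≤ sumFrom g N (suc m)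
sumFrom-≤-suc {g} g≥0 N m = subst (ℚ._≤ sumFrom g N (suc m)) (ℚ.+-identityʳ (sumFrom g N m))
  (ℚ.+-monoʳ-≤ (sumFrom g N m) (g≥0 (N ℕ.+ m)))

-- Telescoping: each new term halves the gap to half^ L.
sumFrom-half^-+-gap : ∀ L m → sumFrom (λ i → half^ (suc (L ℕ.+ i))) 0 m ℚ.+ half^ (L ℕ.+ m) ≡ half^ L
sumFrom-half^-+-gap L zero    = trans (ℚ.+-identityˡ _) (cong half^ (ℕ.+-identityʳ L))
sumFrom-half^-+-gap L (suc m) = begin
  sumFrom h 0 m ℚ.+ half^ (suc (L ℕ.+ m)) ℚ.+ half^ (L ℕ.+ suc m)
    ≡⟨ cong (λ k → sumFrom h 0 m ℚ.+ half^ (suc (L ℕ.+ m)) ℚ.+ half^ k) (ℕ.+-suc L m) ⟩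
  sumFrom h 0 m ℚ.+ half^ (suc (L ℕ.+ m)) ℚ.+ half^ (suc (L ℕ.+ m))
    ≡⟨ ℚ.+-assoc (sumFrom h 0 m) _ _ ⟩
  sumFrom h 0 m ℚ.+ (half^ (suc (L ℕ.+ m)) ℚ.+ half^ (suc (L ℕ.+ m)))
    ≡⟨ cong (sumFrom h 0 m ℚ.+_) (half-+-half (half^ (L ℕ.+ m))) ⟩
  sumFrom h 0 m ℚ.+ half^ (L ℕ.+ m)
    ≡⟨ sumFrom-half^-+-gap L m ⟩
  half^ L
    ∎
  where
  open ≡-Reasoning
  h : ℕ → ℚ
  h i = half^ (suc (L ℕ.+ i))

sumFrom-half^-≤ : ∀ L m → sumFrom (λ i → half^ (suc (L ℕ.+ i))) 0 m ℚ.≤ half^ L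
sumFrom-half^-≤ L m = begin
  sumFrom h 0 m                          ≡⟨ ℚ.+-identityʳ (sumFrom h 0 m) ⟨
  sumFrom h 0 m ℚ.+ 0ℚ                   ≤⟨ ℚ.+-monoʳ-≤ (sumFrom h 0 m) (half^-nonNeg (L ℕ.+ m)) ⟩
  sumFrom h 0 m ℚ.+ half^ (L ℕ.+ m)      ≡⟨ sumFrom-half^-+-gap L m ⟩
  half^ L                                ∎
  where
  open ℚ.≤-Reasoning
  h : ℕ → ℚ
  h i = half^ (suc (L ℕ.+ i))

listSum : (A → ℚ) → List A → ℚ
listSum g []       = 0ℚ
listSum g (x ∷ xs) = g x ℚ.+ listSum g xs

listSum-nonNeg : ∀ (g : A → ℚ) → (∀ x → 0ℚ ℚ.≤ g x) → ∀ xs → 0ℚ ℚ.≤ listSum g xs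
listSum-nonNeg g g≥0 []       = ℚ.≤-refl
listSum-nonNeg g g≥0 (x ∷ xs) =
  subst (ℚ._≤ listSum g (x ∷ xs)) (ℚ.+-identityˡ 0ℚ) (ℚ.+-mono-≤ (g≥0 x) (listSum-nonNeg g g≥0 xs))

-- interleave d b [] is the sequence d 0, b 0, d 1, b 1, …, d i, b i, …; the third argument is
-- what remains of the current block. The fillers d i keep the sequence total when blocks are empty.
interleave : (ℕ → A) → (ℕ → List A) → List A → ℕ → A
interleave d b (x ∷ xs) zero    = x
interleave d b (x ∷ xs) (suc k) = interleave d b xs k
interleave d b []       zero    = d 0
interleave d b []       (suc k) = interleave (d ∘ suc) (b ∘ suc) (b 0) k

interleave-++ : ∀ (d : ℕ → A) b xs k → interleave d b xs (length xs ℕ.+ k) ≡ interleave d b [] k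
interleave-++ d b []       k = refl
interleave-++ d b (x ∷ xs) k = interleave-++ d b xs k

interleave-∈ : ∀ (d : ℕ → A) b {x} xs → x ∈ xs → ∃ λ k → interleave d b xs k ≡ x
interleave-∈ d b (y ∷ ys) (here x≡y)  = 0 , sym x≡y
interleave-∈ d b (y ∷ ys) (there x∈ys) with interleave-∈ d b ys x∈ys
... | k , eq = suc k , eq

interleave-surjective : ∀ (d : ℕ → A) b i {x} → x ∈ b i → ∃ λ k → interleave d b [] k ≡ x
interleave-surjective d b zero    x∈b₀ with interleave-∈ (d ∘ suc) (b ∘ suc) (b 0) x∈b₀
... | k , eq = suc k , eq
interleave-surjective d b (suc i) x∈bᵢ with interleave-surjective (d ∘ suc) (b ∘ suc) i x∈bᵢ
... | k , eq = suc (length (b 0) ℕ.+ k) , trans (interleave-++ (d ∘ suc) (b ∘ suc) (b 0) k) eq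

blockWeight : (A → ℚ) → (ℕ → A) → (ℕ → List A) → ℕ → ℚ
blockWeight g d b i = g (d i) ℚ.+ listSum g (b i)

module _ (g : A → ℚ) (g≥0 : ∀ x → 0ℚ ℚ.≤ g x) where

  blockWeight-nonNeg : ∀ d b i → 0ℚ ℚ.≤ blockWeight g d b i
  blockWeight-nonNeg d b i = subst (ℚ._≤ blockWeight g d b i) (ℚ.+-identityˡ 0ℚ)
    (ℚ.+-mono-≤ (g≥0 (d i)) (listSum-nonNeg g g≥0 (b i)))

  sumFrom-interleave-≤ : ∀ d b xs m →
    sumFrom (g ∘ interleave d b xs) 0 m ℚ.≤ listSum g xs ℚ.+ sumFrom (blockWeight g d b) 0 m
  sumFrom-interleave-≤ d b xs zero = subst (0ℚ ℚ.≤_) (sym (ℚ.+-identityʳ (listSum g xs)))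
    (listSum-nonNeg g g≥0 xs)
  sumFrom-interleave-≤ d b (x ∷ xs) (suc m) = begin
    sumFrom (g ∘ interleave d b (x ∷ xs)) 0 (suc m)         ≡⟨ sumFrom-cons (g ∘ interleave d b (x ∷ xs)) m ⟩
    g x ℚ.+ sumFrom (g ∘ interleave d b xs) 0 m             ≤⟨ ℚ.+-monoʳ-≤ (g x) (sumFrom-interleave-≤ d b xs m) ⟩
    g x ℚ.+ (listSum g xs ℚ.+ sumFrom (blockWeight g d b) 0 m)
      ≤⟨ ℚ.+-monoʳ-≤ (g x) (ℚ.+-monoʳ-≤ (listSum g xs) (sumFrom-≤-suc (blockWeight-nonNeg d b) 0 m)) ⟩
    g x ℚ.+ (listSum g xs ℚ.+ sumFrom (blockWeight g d b) 0 (suc m))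
      ≡⟨ ℚ.+-assoc (g x) (listSum g xs) _ ⟨
    listSum g (x ∷ xs) ℚ.+ sumFrom (blockWeight g d b) 0 (suc m) ∎
    where open ℚ.≤-Reasoning
  sumFrom-interleave-≤ d b [] (suc m) = begin
    sumFrom (g ∘ interleave d b []) 0 (suc m)               ≡⟨ sumFrom-cons (g ∘ interleave d b []) m ⟩
    g (d 0) ℚ.+ sumFrom (g ∘ interleave (d ∘ suc) (b ∘ suc) (b 0)) 0 m
      ≤⟨ ℚ.+-monoʳ-≤ (g (d 0)) (sumFrom-interleave-≤ (d ∘ suc) (b ∘ suc) (b 0) m) ⟩
    g (d 0) ℚ.+ (listSum g (b 0) ℚ.+ sumFrom (blockWeight g d b ∘ suc) 0 m)
      ≡⟨ ℚ.+-assoc (g (d 0)) (listSum g (b 0)) _ ⟨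
    blockWeight g d b 0 ℚ.+ sumFrom (blockWeight g d b ∘ suc) 0 m
      ≡⟨ sumFrom-cons (blockWeight g d b) m ⟨
    sumFrom (blockWeight g d b) 0 (suc m)                     ≡⟨ ℚ.+-identityˡ _ ⟨
    listSum g [] ℚ.+ sumFrom (blockWeight g d b) 0 (suc m)    ∎
    where open ℚ.≤-Reasoning

cylinderMeasure : List Bool → ℚ
cylinderMeasure s = half^ (length s)

cylinderMeasure-nonNeg : ∀ s → 0ℚ ℚ.≤ cylinderMeasure s
cylinderMeasure-nonNeg s = half^-nonNeg (length s)

BlockCover : (Subset → Set) → ℚ → Set
BlockCover T ε = Σ (ℕ → List (List Bool)) λ b →
  (∀ m → sumFrom (listSum cylinderMeasure ∘ b) 0 m ℚ.≤ ε) ×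
  (∀ X → T X → ∃₂ λ i s → s ∈ b i × Extends X s)

-- Enumerate a block cover of measure ε / 2, padding with cylinders of total measure ≤ ε / 2.
blockCovers⇒Null : ∀ {T} → (∀ ε → 0ℚ ℚ.< ε → BlockCover T ε) → Null T
blockCovers⇒Null {T} cover ε ε>0
  with cover (½ ℚ.* ε) (half-pos ε>0) | half^-eventually-≤ (½ ℚ.* ε) (half-pos ε>0)
... | b , b≤½ε , b-covers | L , half^L≤½ε = interleave pad b [] , measure≤ε , covers
  where
  pad : ℕ → List Bool
  pad i = replicate (suc (L ℕ.+ i)) false

  pads≤½ε : ∀ m → sumFrom (cylinderMeasure ∘ pad) 0 m ℚ.≤ ½ ℚ.* ε
  pads≤½ε m = ℚ.≤-trans
    (sumFrom-mono-≤ (λ i → ℚ.≤-reflexive (cong half^ (List.length-replicate (suc (L ℕ.+ i))))) 0 m)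
    (ℚ.≤-trans (sumFrom-half^-≤ L m) half^L≤½ε)

  measure≤ε : ∀ m → sumFrom (cylinderMeasure ∘ interleave pad b []) 0 m ℚ.≤ ε
  measure≤ε m = begin
    sumFrom (cylinderMeasure ∘ interleave pad b []) 0 m
      ≤⟨ sumFrom-interleave-≤ cylinderMeasure cylinderMeasure-nonNeg pad b [] m ⟩
    0ℚ ℚ.+ sumFrom (blockWeight cylinderMeasure pad b) 0 m
      ≡⟨ ℚ.+-identityˡ _ ⟩
    sumFrom (blockWeight cylinderMeasure pad b) 0 m
      ≡⟨ sumFrom-+ (cylinderMeasure ∘ pad) (listSum cylinderMeasure ∘ b) 0 m ⟩
    sumFrom (cylinderMeasure ∘ pad) 0 m ℚ.+ sumFrom (listSum cylinderMeasure ∘ b) 0 m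
      ≤⟨ ℚ.+-mono-≤ (pads≤½ε m) (b≤½ε m) ⟩
    ½ ℚ.* ε ℚ.+ ½ ℚ.* ε
      ≡⟨ half-+-half ε ⟩
    ε ∎
    where open ℚ.≤-Reasoning

  covers : ∀ X → T X → ∃ λ k → Extends X (interleave pad b [] k)
  covers X X∈T with b-covers X X∈T
  ... | i , s , s∈bᵢ , X⊒s with interleave-surjective pad b i s∈bᵢ
  ...   | k , eq = k , subst (Extends X) (sym eq) X⊒s

applyUpTo-tabulate : ∀ (g : ℕ → A) k → applyUpTo g k ≡ toList (tabulate {n = k} (g ∘ toℕ))
applyUpTo-tabulate g zero    = refl
applyUpTo-tabulate g (suc k) = cong (g 0 ∷_) (applyUpTo-tabulate (g ∘ suc) k)

restrict-Extends : ∀ X k → Extends X (toList (restrict X k))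
restrict-Extends X k = begin
  map X (List.upTo (length (toList (restrict X k))))   ≡⟨ cong (map X ∘ List.upTo) (Vec.length-toList (restrict X k)) ⟩
  map X (List.upTo k)                                 ≡⟨ List.map-upTo X k ⟩
  applyUpTo X k                                       ≡⟨ applyUpTo-tabulate X k ⟩
  toList (restrict X k)                               ∎
  where open ≡-Reasoning

listSum-cylinderMeasure-toList : ∀ {k} (vs : List (Vec Bool k)) →
  listSum cylinderMeasure (map toList vs) ≡ + length vs / 1 ℚ.* half^ k
listSum-cylinderMeasure-toList {k} []       = sym (ℚ.*-zeroˡ (half^ k))
listSum-cylinderMeasure-toList {k} (v ∷ vs) = begin
  half^ (length (toList v)) ℚ.+ listSum cylinderMeasure (map toList vs)
    ≡⟨ cong₂ ℚ._+_ (cong half^ (Vec.length-toList v)) (listSum-cylinderMeasure-toList vs) ⟩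
  half^ k ℚ.+ + length vs / 1 ℚ.* half^ k
    ≡⟨ cong (ℚ._+ + length vs / 1 ℚ.* half^ k) (ℚ.*-identityˡ (half^ k)) ⟨
  1ℚ ℚ.* half^ k ℚ.+ + length vs / 1 ℚ.* half^ k
    ≡⟨ ℚ.*-distribʳ-+ (half^ k) 1ℚ (+ length vs / 1) ⟨
  (1ℚ ℚ.+ + length vs / 1) ℚ.* half^ k
    ≡⟨ cong (ℚ._* half^ k) (/1-suc (length vs)) ⟨
  + suc (length vs) / 1 ℚ.* half^ k
    ∎
  where open ≡-Reasoning

positive-unbounded : ∀ {F P} → ContainsCofinite F → Positive F P → ∀ N → ∃ λ n → N ℕ.≤ n × P n
positive-unbounded cofinite P⁺ N
  with P⁺ (λ n → N ≤ᵇ n) (cofinite _ (N , λ n N≤n → Equivalence.to T-≡ (ℕ.≤⇒≤ᵇ N≤n)))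
... | n , Pn , N≤ᵇn = n , ℕ.≤ᵇ⇒≤ N n (Equivalence.from T-≡ N≤ᵇn) , Pn

module _ {f : ℕ → ℕ} (𝒜 : (n : ℕ) → List (Vec Bool (f n))) where

  guessesFrom : ℕ → ℕ → List (List Bool)
  guessesFrom N i = map toList (𝒜 (N ℕ.+ i))

  sumFrom-guessesFrom-≤ : ∀ {π} → (∀ n → length (𝒜 n) ℕ.≤ π n) → ∀ N m →
    sumFrom (listSum cylinderMeasure ∘ guessesFrom N) 0 m ℚ.≤ sumFrom (term π f) N m
  sumFrom-guessesFrom-≤ {π} |𝒜|≤π N m = begin
    sumFrom (listSum cylinderMeasure ∘ guessesFrom N) 0 m
      ≤⟨ sumFrom-mono-≤ (λ i → guesses≤term (N ℕ.+ i)) 0 m ⟩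
    sumFrom (λ i → term π f (N ℕ.+ i)) 0 m
      ≡⟨ sumFrom-shift (term π f) N m ⟨
    sumFrom (term π f) N m ∎
    where
    open ℚ.≤-Reasoning
    guesses≤term : ∀ n → listSum cylinderMeasure (map toList (𝒜 n)) ℚ.≤ term π f n
    guesses≤term n = subst (ℚ._≤ term π f n) (sym (listSum-cylinderMeasure-toList (𝒜 n)))
      (ℚ.*-monoʳ-≤-nonNeg (half^ (f n)) {{ℚ.nonNegative (half^-nonNeg (f n))}} (/1-mono-≤ (|𝒜|≤π n)))

  guessesFrom-cover : ∀ {F} → ContainsCofinite F → ∀ X → Positive F (λ n → restrict X (f n) ∈ 𝒜 n) →
    ∀ N → ∃₂ λ i s → s ∈ guessesFrom N i × Extends X s
  guessesFrom-cover cofinite X guessed N with positive-unbounded cofinite guessed N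
  ... | n , N≤n , guess∈𝒜ₙ = n ∸ N , toList (restrict X (f n)) , guess∈ , restrict-Extends X (f n)
    where
    guess∈ : toList (restrict X (f n)) ∈ guessesFrom N (n ∸ N)
    guess∈ = subst (λ m → toList (restrict X (f n)) ∈ map toList (𝒜 m)) (sym (ℕ.m+[n∸m]≡n N≤n))
      (∈-map⁺ toList guess∈𝒜ₙ)

mainTheorem2 : (F : Subset → Set) → IsFilter F → ContainsCofinite F →
    (π f : ℕ → ℕ) → (T : Subset → Set) →
    Diamond⁻ F π f T → Converges (term π f) → Null T
mainTheorem2 F _ cofinite π f T (𝒜 , |𝒜|≤π , guessed) converges = blockCovers⇒Null cover
  where
  cover : ∀ ε → 0ℚ ℚ.< ε → BlockCover T ε
  cover ε ε>0 with converges ε ε>0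
  ... | N , tail≤ε =
    guessesFrom 𝒜 N ,
    (λ m → ℚ.≤-trans (sumFrom-guessesFrom-≤ 𝒜 |𝒜|≤π N m) (tail≤ε m)) ,
    (λ X X∈T → guessesFrom-cover 𝒜 cofinite X (guessed X X∈T) N)
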